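{- Let $p$ be a prime greater than $2$, $n$ a positive integer, and $f \colon GF(p)^n \to GF(p)$ an even function with $f(0)=0$ that determines an association scheme with structure constants $\rho_{ij}^k$ ($0\le i,j,k\le p$). Then $f$ is bent if and only if \[ \left(\sum_{k=0}^{p} \rho^i_{(j+k \bmod p),\,k}\right) + \rho^i_{p,\,p-j} = p^{n-1} \] for all $1 \le i \le p$ and $1 \le j \le p-1$, where $j+k \bmod p$ denotes the representative in $\{0,1,\dots,p-1\}$.
   Context: Let $\zeta = e^{2\pi i/p}$ and identify $GF(p)$ with $\{0,\dots,p-1\}$. $W_f(x) = \sum_y \zeta^{f(y)-\langle x,y\rangle}$ with $\langle\ ,\ \rangle$ the standard inner product; $f$ is bent if $|W_f(x)| = p^{n/2}$ for all $x$. Let $D_0 = \{0\}$, $D_i = f^{ -1}(i)$ for $1 \le i \le p-1$, $D_p = f^{ -1}(0)\setminus\{0\}$. Define relations on $V = GF(p)^n$ by $R_i = \{(x,y) \mid x - y \in D_i\}$ for $0 \le i \le p$. For $(x,y)\in R_k$ let $\rho_{ij}^k(x,y) = |\{z \in V \mid (x,z)\in R_i,\ (z,y)\in R_j\}|$. The function $f$ determines an association scheme if for all $i,j,k$ the number $\rho_{ij}^k(x,y)$ is the same for every $(x,y)\in R_k$; this common value is the structure constant $\rho_{ij}^k$. -}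

module Defs where

open import Data.Nat using (ℕ; zero; suc; _+_; _*_; _∸_; _^_; _≡ᵇ_; NonZero)
open import Data.Nat.DivMod using (_mod_)
open import Data.Fin using (Fin; toℕ)
open import Data.Vec using (Vec; []; _∷_; map; zipWith; replicate)
open import Data.List using (List; []; _∷_; allFin; concatMap; foldr; length; filter)
import Data.List as L
open import Data.Bool using (Bool; true; false; if_then_else_; _∧_; not; T)
open import Data.Integer using (ℤ; +_) renaming (_+_ to _+ℤ_; _*_ to _*ℤ_)
open import Data.Product using (∃)
open import Relation.Binary.PropositionalEquality using (_≡_)

count : {A : Set} → (A → Bool) → List A → ℕ
count P []       = 0
count P (a ∷ as) = if P a then suc (count P as) else count P as

sumUpTo : ℕ → (ℕ → ℕ) → ℕ
sumUpTo zero    g = g 0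
sumUpTo (suc m) g = sumUpTo m g + g (suc m)

module _ (p : ℕ) .{{_ : NonZero p}} where

  _+F_ : Fin p → Fin p → Fin p
  a +F b = (toℕ a + toℕ b) mod p

  negF : Fin p → Fin p
  negF a = (p ∸ toℕ a) mod p

  _-F_ : Fin p → Fin p → Fin p
  a -F b = a +F negF b

  _*F_ : Fin p → Fin p → Fin p
  a *F b = (toℕ a * toℕ b) mod p

  0F : Fin p
  0F = 0 mod p

  _==F_ : Fin p → Fin p → Bool
  a ==F b = toℕ a ≡ᵇ toℕ b

  subV : ∀ {n} → Vec (Fin p) n → Vec (Fin p) n → Vec (Fin p) n
  subV = zipWith _-F_

  negV : ∀ {n} → Vec (Fin p) n → Vec (Fin p) n
  negV = map negF

  zeroV : ∀ n → Vec (Fin p) n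
  zeroV n = replicate n 0F

  isZeroV : ∀ {n} → Vec (Fin p) n → Bool
  isZeroV []       = true
  isZeroV (a ∷ v)  = (a ==F 0F) ∧ isZeroV v

  inner : ∀ {n} → Vec (Fin p) n → Vec (Fin p) n → Fin p
  inner []       []       = 0F
  inner (a ∷ x)  (b ∷ y)  = (a *F b) +F inner x y

  allV : ∀ n → List (Vec (Fin p) n)
  allV zero    = [] ∷ []
  allV (suc n) = concatMap (λ a → L.map (a ∷_) (allV n)) (allFin p)

  Even : ∀ {n} → (Vec (Fin p) n → Fin p) → Set
  Even f = ∀ x → f (negV x) ≡ f x

  -- membership in D_i (i ∈ {0,…,p}; for i > p, D_i is empty):
  -- D_0 = {0}, D_i = f⁻¹(i) for 1 ≤ i ≤ p-1, D_p = f⁻¹(0) \ {0}.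
  inD : ∀ {n} → (Vec (Fin p) n → Fin p) → ℕ → Vec (Fin p) n → Bool
  inD f i v =
    if i ≡ᵇ 0 then isZeroV v
    else if i ≡ᵇ p then ((toℕ (f v) ≡ᵇ 0) ∧ not (isZeroV v))
    else toℕ (f v) ≡ᵇ i

  R : ∀ {n} → (Vec (Fin p) n → Fin p) → ℕ → Vec (Fin p) n → Vec (Fin p) n → Set
  R f i x y = T (inD f i (subV x y))

  ρ : ∀ {n} → (Vec (Fin p) n → Fin p) → ℕ → ℕ → Vec (Fin p) n → Vec (Fin p) n → ℕ
  ρ {n} f i j x y = count (λ z → inD f i (subV x z) ∧ inD f j (subV z y)) (allV n)

  DeterminesAS : ∀ {n} → (Vec (Fin p) n → Fin p) → Set
  DeterminesAS f = ∀ i j k → i Data.Nat.≤ p → j Data.Nat.≤ p → k Data.Nat.≤ p →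
    ∀ x y x′ y′ → R f k x y → R f k x′ y′ → ρ f i j x y ≡ ρ f i j x′ y′

  -- Cyclotomic integers ℤ[ζ], ζ = e^{2πi/p}: an element Σ_e a_e ζ^e is
  -- represented by its coefficient function a : Fin p → ℤ.  Since p is
  -- prime, Σ a_e ζ^e = Σ b_e ζ^e in ℂ iff a - b is a constant vector
  -- (the only relation being 1 + ζ + … + ζ^{p-1} = 0).
  Cyc : Set
  Cyc = Fin p → ℤ

  _≈C_ : Cyc → Cyc → Set
  a ≈C b = ∃ λ (c : ℤ) → ∀ e → a e ≡ b e +ℤ c

  sumℤ : List ℤ → ℤ
  sumℤ = foldr _+ℤ_ (+ 0)

  _*C_ : Cyc → Cyc → Cyc
  (a *C b) e = sumℤ (L.map (λ c → a c *ℤ b (e -F c)) (allFin p))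

  -- complex conjugation: ζ^e ↦ ζ^{-e}
  conjC : Cyc → Cyc
  conjC a e = a (negF e)

  constC : ℕ → Cyc
  constC m e = if toℕ e ≡ᵇ 0 then + m else + 0

  -- Walsh transform W_f(x) = Σ_y ζ^{f(y) - ⟨x,y⟩}: the coefficient of ζ^e
  -- is the number of y with f(y) - ⟨x,y⟩ = e.
  W : ∀ {n} → (Vec (Fin p) n → Fin p) → Vec (Fin p) n → Cyc
  W {n} f x e = + count (λ y → (f y -F inner x y) ==F e) (allV n)

  -- f is bent: |W_f(x)| = p^{n/2} for all x, i.e. W_f(x)·conj(W_f(x)) = p^n.
  Bent : ∀ {n} → (Vec (Fin p) n → Fin p) → Set
  Bent {n} f = ∀ x → (W f x *C conjC (W f x)) ≈C constC (p ^ n)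

module Submission where

-- Write N_w(c) for the number of a with Δ_w f(a) = f(a) − f(a − w) = c.  Reading
-- W_f(x)·conj W_f(x) coefficientwise in ℤ[ζ] and substituting y′ = y − w shows that its
-- coefficient of ζ^e is p^n [e = 0] + Σ_{w ≠ 0} N_w(e + ⟨x, w⟩), so f is bent iff the sum
-- is independent of e for every x.  Balanced derivatives (N_w ≡ p^{n−1} for w ≠ 0) clearly
-- suffice; conversely, averaging over x at e − ⟨x, w₀⟩ turns the term of w into a
-- character sum over ⟨x, w − w₀⟩, which is independent of e unless w = w₀, so N_{w₀}
-- must be constant.
-- On the scheme side, class(v) ≡ f(v) (mod p), and the intersection numbers in the sum
-- count the z with class(x − z) ≡ j + class(z − y) (mod p), split by k = class(z − y); the
-- term ρ_{p,p−j} catches class(x − z) = p, which (j + k) mod p never reaches.  So the sum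
-- counts the z with f(x − z) − f(z − y) = j, and as f is even, z = x − a turns it into
-- N_{x−y}(j).

open import Defs
open import Data.Nat using (ℕ; _+_; _∸_; _^_; _≤_; _<_; _%_; NonZero)
open import Data.Nat.Primality using (Prime)
open import Data.Fin using (Fin)
open import Data.Vec using (Vec)
open import Function.Bundles using (_⇔_)
open import Relation.Binary.PropositionalEquality using (_≡_)

open import Level using (0ℓ)
open import Function using (_∘_; _$_; id)
open import Function.Bundles using (mk⇔; Equivalence)
import Function.Properties.Equivalence as ⇔
open import Function.Related.Propositional as Related using (equivalence)
open import Relation.Binary.PropositionalEquality
  using (refl; sym; trans; cong; cong₂; subst; _≢_; isEquivalence; module ≡-Reasoning)
open import Relation.Binary.Definitions using (DecidableEquality)
open import Relation.Nullary using (does; yes; no; contradiction)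
open import Relation.Nullary.Decidable using (map′; dec-true; dec-false; does-⇔)
open import Data.Bool using (Bool; true; false; _∧_; not; if_then_else_; T)
open import Data.Sum using (inj₁; inj₂)
open import Data.Product using (_,_; ∃)
open import Data.Nat as ℕ using (zero; suc; _*_; z≤n; s≤s)
import Data.Nat.Properties as ℕ
open import Data.Nat.DivMod
  using (_mod_; %-distribˡ-+; %-distribˡ-*; m<n⇒m%n≡m; n%n≡0; m*n%n≡0; [m+kn]%n≡m%n; m%n<n; m≤n⇒[n∸m]%m≡n%m)
open import Data.Nat.Coprimality using (prime⇒coprime; coprime-Bézout)
open import Data.Nat.GCD using (module Bézout)
open import Data.Integer as ℤ using (ℤ) renaming (_+_ to _+ℤ_; _*_ to _*ℤ_)
import Data.Integer.Properties as ℤ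
open import Data.Fin using (toℕ; punchIn) renaming (zero to fzero; suc to fsuc)
open import Data.Fin.Properties using (toℕ-injective; toℕ-fromℕ<; toℕ<n; punchInᵢ≢i)
open import Data.Fin.Permutation using (permutation)
open import Data.List as List using (List; []; _∷_; _++_; concatMap; tabulate)
open import Data.Vec using ([]; _∷_)
open import Data.Vec.Properties using (≡-dec; ∷-injectiveˡ; ∷-injectiveʳ)
open import Algebra.Bundles using (AbelianGroup; CommutativeRing)
open import Algebra.Consequences.Propositional using (comm∧idʳ⇒id; comm∧invʳ⇒inv; comm∧distrˡ⇒distrʳ)
open import Algebra.Properties.CommutativeMonoid.Sum ℕ.+-0-commutativeMonoid
  using (sum; sum-cong-≗; sum-remove; sum-permute; ∑-distrib-+; ∑-comm)
open import Algebra.Properties.Semiring.Sum ℕ.+-*-semiring using (*-distribˡ-sum)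
import Algebra.Properties.CommutativeSemigroup ℕ.*-commutativeSemigroup as ℕ-*
import Algebra.Properties.AbelianGroup ℤ.+-0-abelianGroup as ℤ-AbelianGroup

module AbelianGroupProperties {a ℓ} (G : AbelianGroup a ℓ) where

  open AbelianGroup G renaming (refl to ≈-refl; sym to ≈-sym; trans to ≈-trans)
  open import Algebra.Properties.AbelianGroup G public
  open import Algebra.Properties.CommutativeSemigroup commutativeSemigroup
    using (interchange; xy∙z≈xz∙y)
  open import Algebra.Properties.CommutativeSemigroup commutativeSemigroup public
    using (xy∙z≈x∙zy)
  open import Relation.Binary.Reasoning.Setoid setoid

  [w∙x]-[y∙z]≈[w-y]∙[x-z] : ∀ w x y z → (w ∙ x) - (y ∙ z) ≈ (w - y) ∙ (x - z)
  [w∙x]-[y∙z]≈[w-y]∙[x-z] w x y z = begin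
    (w ∙ x) - (y ∙ z)          ≈⟨ ∙-congˡ (⁻¹-∙-comm y z) ⟨
    (w ∙ x) ∙ (y ⁻¹ ∙ z ⁻¹)    ≈⟨ interchange w x (y ⁻¹) (z ⁻¹) ⟩
    (w - y) ∙ (x - z)          ∎

  [w-x]-[y-z]≈[w-y]-[x-z] : ∀ w x y z → (w - x) - (y - z) ≈ (w - y) - (x - z)
  [w-x]-[y-z]≈[w-y]-[x-z] w x y z = begin
    (w - x) - (y - z)          ≈⟨ [w∙x]-[y∙z]≈[w-y]∙[x-z] w (x ⁻¹) y (z ⁻¹) ⟩
    (w - y) ∙ (x ⁻¹ - z ⁻¹)    ≈⟨ ∙-congˡ (∙-congˡ (⁻¹-involutive z)) ⟩
    (w - y) ∙ (x ⁻¹ ∙ z)       ≈⟨ ∙-congˡ (comm (x ⁻¹) z) ⟩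
    (w - y) ∙ (z - x)          ≈⟨ ∙-congˡ (⁻¹-anti-homo‿- x z) ⟨
    (w - y) - (x - z)          ∎

  [x-y]-z≈[x-z]-y : ∀ x y z → (x - y) - z ≈ (x - z) - y
  [x-y]-z≈[x-z]-y x y z = xy∙z≈xz∙y x (y ⁻¹) (z ⁻¹)

  x-[x-y]≈y : ∀ x y → x - (x - y) ≈ y
  x-[x-y]≈y x y = begin
    x - (x - y)    ≈⟨ ∙-congˡ (⁻¹-anti-homo‿- x y) ⟩
    x ∙ (y - x)    ≈⟨ comm x (y - x) ⟩
    (y - x) ∙ x    ≈⟨ //-rightDividesˡ x y ⟩
    y              ∎

  x-y≈z⇔x≈z∙y : ∀ {x y z} → x - y ≈ z ⇔ x ≈ z ∙ y
  x-y≈z⇔x≈z∙y {x} {y} {z} = mk⇔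
    (λ x-y≈z → ≈-trans (≈-sym (//-rightDividesˡ y x)) (∙-congʳ x-y≈z))
    (λ x≈z∙y → ≈-trans (//-cong₂ x≈z∙y ≈-refl) (//-rightDividesʳ y z))

  x-y≈z⇔x-z≈y : ∀ {x y z} → x - y ≈ z ⇔ x - z ≈ y
  x-y≈z⇔x-z≈y {x} {y} {z} = mk⇔
    (λ x-y≈z → Equivalence.from x-y≈z⇔x≈z∙y (≈-trans (Equivalence.to x-y≈z⇔x≈z∙y x-y≈z) (comm z y)))
    (λ x-z≈y → Equivalence.from x-y≈z⇔x≈z∙y (≈-trans (Equivalence.to x-y≈z⇔x≈z∙y x-z≈y) (comm y z)))

𝟙 : Bool → ℕ
𝟙 true  = 1
𝟙 false = 0

𝟙-∧ : ∀ b c → 𝟙 (b ∧ c) ≡ 𝟙 b * 𝟙 c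
𝟙-∧ false c = refl
𝟙-∧ true  c = sym (ℕ.+-identityʳ (𝟙 c))

sum-const : ∀ q c → sum {q} (λ _ → c) ≡ q * c
sum-const zero    c = refl
sum-const (suc q) c = cong (c +_) (sum-const q c)

sum-except-const : ∀ {q} (t : Fin (suc q) → ℕ) i c → (∀ j → j ≢ i → t j ≡ c) →
  sum t ≡ t i + q * c
sum-except-const {q} t i c t≡c = begin
  sum t                                   ≡⟨ sum-remove t ⟩
  t i + sum (λ j → t (punchIn i j))       ≡⟨ cong (t i +_) (sum-cong-≗ λ j → t≡c _ (punchInᵢ≢i i j)) ⟩
  t i + sum {q} (λ _ → c)                 ≡⟨ cong (t i +_) (sum-const q c) ⟩
  t i + q * c                             ∎
  where open ≡-Reasoning

sum-except⇒≡ : ∀ q .{{_ : NonZero q}} (t : Fin q → ℕ) i c → (∀ j → j ≢ i → t j ≡ c) →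
  sum t ≡ q * c → t i ≡ c
sum-except⇒≡ (suc q) t i c t≡c sum≡ = ℕ.+-cancelʳ-≡ (q * c) (t i) c
  (trans (sym (sum-except-const t i c t≡c)) sum≡)

sum-indicator : ∀ {q} (_≟_ : DecidableEquality (Fin q)) (h : Fin q → ℕ) i →
  sum (λ j → 𝟙 (does (j ≟ i)) * h j) ≡ h i
sum-indicator {suc q} _≟_ h i = begin
  sum (λ j → 𝟙 (does (j ≟ i)) * h j)        ≡⟨ sum-except-const _ i 0 (λ j j≢i → cong (λ b → 𝟙 b * h j) (dec-false (j ≟ i) j≢i)) ⟩
  𝟙 (does (i ≟ i)) * h i + q * 0            ≡⟨ cong₂ (λ b z → 𝟙 b * h i + z) (dec-true (i ≟ i) refl) (ℕ.*-zeroʳ q) ⟩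
  1 * h i + 0                               ≡⟨ ℕ.+-identityʳ (1 * h i) ⟩
  1 * h i                                   ≡⟨ ℕ.*-identityˡ (h i) ⟩
  h i                                       ∎
  where open ≡-Reasoning

sum-bijection : ∀ {q} (h : Fin q → ℕ) (σ σ⁻¹ : Fin q → Fin q) →
  (∀ j → σ⁻¹ (σ j) ≡ j) → (∀ j → σ (σ⁻¹ j) ≡ j) → sum (λ j → h (σ j)) ≡ sum h
sum-bijection h σ σ⁻¹ left right = sym (sum-permute h (permutation σ σ⁻¹ right left))

count-++ : ∀ {A : Set} (P : A → Bool) xs ys → count P (xs ++ ys) ≡ count P xs + count P ys
count-++ P []       ys = refl
count-++ P (x ∷ xs) ys with P x
... | true  = cong suc (count-++ P xs ys)
... | false = count-++ P xs ys

count-map : ∀ {A B : Set} (P : B → Bool) (g : A → B) xs → count P (List.map g xs) ≡ count (P ∘ g) xs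
count-map P g []       = refl
count-map P g (x ∷ xs) with P (g x)
... | true  = cong suc (count-map P g xs)
... | false = count-map P g xs

count-concatMap-tabulate : ∀ {A B : Set} {q} (P : B → Bool) (g : A → List B) (t : Fin q → A) →
  count P (concatMap g (tabulate t)) ≡ sum (λ i → count P (g (t i)))
count-concatMap-tabulate {q = zero}  P g t = refl
count-concatMap-tabulate {q = suc q} P g t =
  trans (count-++ P (g (t fzero)) _) (cong (count P (g (t fzero)) +_) (count-concatMap-tabulate P g (t ∘ fsuc)))

≡ᵇ-false : ∀ {m n} → m ≢ n → (m ℕ.≡ᵇ n) ≡ false
≡ᵇ-false {m} {n} = dec-false (m ℕ.≟ n)

≡ᵇ-true : ∀ {m n} → m ≡ n → (m ℕ.≡ᵇ n) ≡ true
≡ᵇ-true {m} {n} = dec-true (m ℕ.≟ n)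

≡ᵇ-cong-⇔ : ∀ {m n m′ n′} → m ≡ n ⇔ m′ ≡ n′ → (m ℕ.≡ᵇ n) ≡ (m′ ℕ.≡ᵇ n′)
≡ᵇ-cong-⇔ {m} {n} {m′} {n′} equiv = does-⇔ equiv (m ℕ.≟ n) (m′ ℕ.≟ n′)

≤pred⇒< : ∀ {m n} .{{_ : NonZero n}} → m ≤ n ∸ 1 → m < n
≤pred⇒< {n = suc _} = s≤s

sumUpTo-cong : ∀ m {g h : ℕ → ℕ} → (∀ k → g k ≡ h k) → sumUpTo m g ≡ sumUpTo m h
sumUpTo-cong zero    g≗h = g≗h 0
sumUpTo-cong (suc m) g≗h = cong₂ _+_ (sumUpTo-cong m g≗h) (g≗h (suc m))

sumUpTo-indicator-above : ∀ m b (h : ℕ → ℕ) → m < b → sumUpTo m (λ k → 𝟙 (k ℕ.≡ᵇ b) * h k) ≡ 0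
sumUpTo-indicator-above zero    b h 0<b = cong (λ c → 𝟙 c * h 0) (≡ᵇ-false (ℕ.<⇒≢ 0<b))
sumUpTo-indicator-above (suc m) b h m<b = cong₂ _+_
  (sumUpTo-indicator-above m b h (ℕ.<-trans (ℕ.n<1+n m) m<b))
  (cong (λ c → 𝟙 c * h (suc m)) (≡ᵇ-false (ℕ.<⇒≢ m<b)))

sumUpTo-indicator : ∀ m b (h : ℕ → ℕ) → b ≤ m → sumUpTo m (λ k → 𝟙 (k ℕ.≡ᵇ b) * h k) ≡ h b
sumUpTo-indicator zero    zero h z≤n = ℕ.+-identityʳ (h 0)
sumUpTo-indicator (suc m) b    h b≤1+m with ℕ.m≤n⇒m<n∨m≡n b≤1+m
... | inj₁ (s≤s b≤m) = trans
  (cong₂ _+_ (sumUpTo-indicator m b h b≤m) (cong (λ c → 𝟙 c * h (suc m)) (≡ᵇ-false (ℕ.<⇒≢ (s≤s b≤m) ∘ sym))))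
  (ℕ.+-identityʳ (h b))
... | inj₂ refl = trans
  (cong₂ _+_ (sumUpTo-indicator-above m (suc m) h ℕ.≤-refl) (cong (λ c → 𝟙 c * h (suc m)) (≡ᵇ-true {suc m} refl)))
  (ℕ.+-identityʳ (h (suc m)))

module _ {p : ℕ} .{{_ : NonZero p}} where

  [j+b]%p≡0⇒j+b≡p : ∀ {j b} → 0 < j → j < p → b ≤ p → (j + b) % p ≡ 0 → j + b ≡ p
  [j+b]%p≡0⇒j+b≡p {j} {b} 0<j j<p b≤p [j+b]%p≡0 with j + b ℕ.<? p
  ... | yes j+b<p = contradiction (trans (sym (m<n⇒m%n≡m j+b<p)) [j+b]%p≡0)
                                  (ℕ.m<n⇒n≢0 (ℕ.<-≤-trans 0<j (ℕ.m≤m+n j b)))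
  ... | no  j+b≮p = ℕ.≤-antisym (ℕ.m∸n≡0⇒m≤n (begin
    j + b ∸ p            ≡⟨ m<n⇒m%n≡m (ℕ.m<n+o⇒m∸n<o (j + b) p (ℕ.+-mono-<-≤ j<p b≤p)) ⟨
    (j + b ∸ p) % p      ≡⟨ m≤n⇒[n∸m]%m≡n%m p≤j+b ⟩
    (j + b) % p          ≡⟨ [j+b]%p≡0 ⟩
    0                    ∎)) p≤j+b
    where
    open ≡-Reasoning
    p≤j+b : p ≤ j + b
    p≤j+b = ℕ.≮⇒≥ j+b≮p

  𝟙-intersection : ∀ {j a b} → 0 < j → j < p → a ≤ p → b ≤ p →
    𝟙 ((j + b) % p ℕ.≡ᵇ a) + 𝟙 ((p ℕ.≡ᵇ a) ∧ (p ∸ j ℕ.≡ᵇ b)) ≡ 𝟙 (a % p ℕ.≡ᵇ (j + b) % p)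
  𝟙-intersection {j} {a} {b} 0<j j<p a≤p b≤p with ℕ.m≤n⇒m<n∨m≡n a≤p
  ... | inj₁ a<p = begin
    𝟙 ((j + b) % p ℕ.≡ᵇ a) + 𝟙 ((p ℕ.≡ᵇ a) ∧ (p ∸ j ℕ.≡ᵇ b))  ≡⟨ cong (λ c → 𝟙 ((j + b) % p ℕ.≡ᵇ a) + 𝟙 (c ∧ (p ∸ j ℕ.≡ᵇ b))) (≡ᵇ-false (ℕ.<⇒≢ a<p ∘ sym)) ⟩
    𝟙 ((j + b) % p ℕ.≡ᵇ a) + 0                               ≡⟨ ℕ.+-identityʳ _ ⟩
    𝟙 ((j + b) % p ℕ.≡ᵇ a)                                   ≡⟨ cong 𝟙 (≡ᵇ-cong-⇔ (mk⇔ (λ eq → trans a%p≡a (sym eq)) (λ eq → trans (sym eq) a%p≡a))) ⟩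
    𝟙 (a % p ℕ.≡ᵇ (j + b) % p)                               ∎
    where
    open ≡-Reasoning
    a%p≡a : a % p ≡ a
    a%p≡a = m<n⇒m%n≡m a<p
  ... | inj₂ refl = begin
    𝟙 ((j + b) % p ℕ.≡ᵇ p) + 𝟙 ((p ℕ.≡ᵇ p) ∧ (p ∸ j ℕ.≡ᵇ b))  ≡⟨ cong₂ (λ c d → 𝟙 c + 𝟙 (d ∧ (p ∸ j ℕ.≡ᵇ b))) (≡ᵇ-false (ℕ.<⇒≢ (m%n<n (j + b) p))) (≡ᵇ-true {p} refl) ⟩
    𝟙 (p ∸ j ℕ.≡ᵇ b)                                         ≡⟨ cong 𝟙 (≡ᵇ-cong-⇔ (mk⇔ to from)) ⟩
    𝟙 (p % p ℕ.≡ᵇ (j + b) % p)                               ∎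
    where
    open ≡-Reasoning
    to : p ∸ j ≡ b → p % p ≡ (j + b) % p
    to p∸j≡b = cong (_% p) (trans (sym (ℕ.m+[n∸m]≡n (ℕ.<⇒≤ j<p))) (cong (j +_) p∸j≡b))
    from : p % p ≡ (j + b) % p → p ∸ j ≡ b
    from eq = trans (cong (_∸ j) (sym ([j+b]%p≡0⇒j+b≡p 0<j j<p b≤p (trans (sym eq) (n%n≡0 p))))) (ℕ.m+n∸m≡n j b)

module ZMod (p : ℕ) .{{_ : NonZero p}} where

  infixl 6 _+ₚ_ _-ₚ_
  infixl 7 _*ₚ_
  infix 4 _≟ₚ_

  _+ₚ_ _-ₚ_ _*ₚ_ : Fin p → Fin p → Fin p
  _+ₚ_ = _+F_ p
  _-ₚ_ = _-F_ p
  _*ₚ_ = _*F_ p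

  negₚ : Fin p → Fin p
  negₚ = negF p

  0ₚ 1ₚ : Fin p
  0ₚ = 0F p
  1ₚ = 1 mod p

  -- does (a ≟ₚ b) is definitionally a ==F b, which fails for Data.Fin.Properties._≟_.
  _≟ₚ_ : DecidableEquality (Fin p)
  a ≟ₚ b = map′ toℕ-injective (cong toℕ) (toℕ a ℕ.≟ toℕ b)

  does-≟ₚ-sym : ∀ a b → does (a ≟ₚ b) ≡ does (b ≟ₚ a)
  does-≟ₚ-sym a b = does-⇔ (mk⇔ sym sym) (a ≟ₚ b) (b ≟ₚ a)

  toℕ-mod : ∀ m → toℕ (m mod p) ≡ m % p
  toℕ-mod m = toℕ-fromℕ< _

  mod-toℕ : ∀ a → toℕ a mod p ≡ a
  mod-toℕ a = toℕ-injective (trans (toℕ-mod (toℕ a)) (m<n⇒m%n≡m (toℕ<n a)))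

  mod-cong : ∀ {m n} → m % p ≡ n % p → m mod p ≡ n mod p
  mod-cong eq = toℕ-injective (trans (toℕ-mod _) (trans eq (sym (toℕ-mod _))))

  toℕ-0ₚ : toℕ 0ₚ ≡ 0
  toℕ-0ₚ = trans (toℕ-mod 0) (m*n%n≡0 0 p)

  mod-≡0 : ∀ {m} → m % p ≡ 0 → m mod p ≡ 0ₚ
  mod-≡0 m%p≡0 = mod-cong (trans m%p≡0 (sym (m*n%n≡0 0 p)))

  mod-+ : ∀ m n → (m + n) mod p ≡ (m mod p) +ₚ (n mod p)
  mod-+ m n = mod-cong (begin
    (m + n) % p                                  ≡⟨ %-distribˡ-+ m n p ⟩
    (m % p + n % p) % p                          ≡⟨ cong₂ (λ a b → (a + b) % p) (toℕ-mod m) (toℕ-mod n) ⟨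
    (toℕ (m mod p) + toℕ (n mod p)) % p          ∎)
    where open ≡-Reasoning

  mod-* : ∀ m n → (m * n) mod p ≡ (m mod p) *ₚ (n mod p)
  mod-* m n = mod-cong (begin
    (m * n) % p                                  ≡⟨ %-distribˡ-* m n p ⟩
    (m % p * (n % p)) % p                        ≡⟨ cong₂ (λ a b → (a * b) % p) (toℕ-mod m) (toℕ-mod n) ⟨
    (toℕ (m mod p) * toℕ (n mod p)) % p          ∎)
    where open ≡-Reasoning

  private
    open ≡-Reasoning

    +ₚ-assoc : ∀ a b c → (a +ₚ b) +ₚ c ≡ a +ₚ (b +ₚ c)
    +ₚ-assoc a b c = begin
      (a +ₚ b) +ₚ c                              ≡⟨ cong ((a +ₚ b) +ₚ_) (mod-toℕ c) ⟨
      ((toℕ a + toℕ b) mod p) +ₚ (toℕ c mod p)    ≡⟨ mod-+ (toℕ a + toℕ b) (toℕ c) ⟨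
      (toℕ a + toℕ b + toℕ c) mod p               ≡⟨ cong (_mod p) (ℕ.+-assoc (toℕ a) _ _) ⟩
      (toℕ a + (toℕ b + toℕ c)) mod p             ≡⟨ mod-+ (toℕ a) _ ⟩
      (toℕ a mod p) +ₚ ((toℕ b + toℕ c) mod p)    ≡⟨ cong (_+ₚ (b +ₚ c)) (mod-toℕ a) ⟩
      a +ₚ (b +ₚ c)                              ∎

    *ₚ-assoc : ∀ a b c → (a *ₚ b) *ₚ c ≡ a *ₚ (b *ₚ c)
    *ₚ-assoc a b c = begin
      (a *ₚ b) *ₚ c                              ≡⟨ cong ((a *ₚ b) *ₚ_) (mod-toℕ c) ⟨
      ((toℕ a * toℕ b) mod p) *ₚ (toℕ c mod p)    ≡⟨ mod-* (toℕ a * toℕ b) (toℕ c) ⟨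
      (toℕ a * toℕ b * toℕ c) mod p               ≡⟨ cong (_mod p) (ℕ.*-assoc (toℕ a) _ _) ⟩
      (toℕ a * (toℕ b * toℕ c)) mod p             ≡⟨ mod-* (toℕ a) _ ⟩
      (toℕ a mod p) *ₚ ((toℕ b * toℕ c) mod p)    ≡⟨ cong (_*ₚ (b *ₚ c)) (mod-toℕ a) ⟩
      a *ₚ (b *ₚ c)                              ∎

    +ₚ-comm : ∀ a b → a +ₚ b ≡ b +ₚ a
    +ₚ-comm a b = cong (_mod p) (ℕ.+-comm (toℕ a) (toℕ b))

    *ₚ-comm : ∀ a b → a *ₚ b ≡ b *ₚ a
    *ₚ-comm a b = cong (_mod p) (ℕ.*-comm (toℕ a) (toℕ b))

    +ₚ-identityʳ : ∀ a → a +ₚ 0ₚ ≡ a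
    +ₚ-identityʳ a = begin
      a +ₚ 0ₚ                   ≡⟨ cong (_+ₚ 0ₚ) (mod-toℕ a) ⟨
      (toℕ a mod p) +ₚ (0 mod p) ≡⟨ mod-+ (toℕ a) 0 ⟨
      (toℕ a + 0) mod p         ≡⟨ cong (_mod p) (ℕ.+-identityʳ (toℕ a)) ⟩
      toℕ a mod p               ≡⟨ mod-toℕ a ⟩
      a                         ∎

    *ₚ-identityʳ : ∀ a → a *ₚ 1ₚ ≡ a
    *ₚ-identityʳ a = begin
      a *ₚ 1ₚ                   ≡⟨ cong (_*ₚ 1ₚ) (mod-toℕ a) ⟨
      (toℕ a mod p) *ₚ (1 mod p) ≡⟨ mod-* (toℕ a) 1 ⟨
      (toℕ a * 1) mod p         ≡⟨ cong (_mod p) (ℕ.*-identityʳ (toℕ a)) ⟩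
      toℕ a mod p               ≡⟨ mod-toℕ a ⟩
      a                         ∎

    +ₚ-inverseʳ : ∀ a → a +ₚ negₚ a ≡ 0ₚ
    +ₚ-inverseʳ a = begin
      a +ₚ negₚ a                         ≡⟨ cong (_+ₚ negₚ a) (mod-toℕ a) ⟨
      (toℕ a mod p) +ₚ ((p ∸ toℕ a) mod p) ≡⟨ mod-+ (toℕ a) (p ∸ toℕ a) ⟨
      (toℕ a + (p ∸ toℕ a)) mod p        ≡⟨ cong (_mod p) (ℕ.m+[n∸m]≡n (ℕ.<⇒≤ (toℕ<n a))) ⟩
      p mod p                           ≡⟨ mod-≡0 (n%n≡0 p) ⟩
      0ₚ                                ∎

    *ₚ-distribˡ-+ₚ : ∀ a b c → a *ₚ (b +ₚ c) ≡ a *ₚ b +ₚ a *ₚ c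
    *ₚ-distribˡ-+ₚ a b c = begin
      a *ₚ (b +ₚ c)                                   ≡⟨ cong (_*ₚ (b +ₚ c)) (mod-toℕ a) ⟨
      (toℕ a mod p) *ₚ ((toℕ b + toℕ c) mod p)         ≡⟨ mod-* (toℕ a) _ ⟨
      (toℕ a * (toℕ b + toℕ c)) mod p                  ≡⟨ cong (_mod p) (ℕ.*-distribˡ-+ (toℕ a) _ _) ⟩
      (toℕ a * toℕ b + toℕ a * toℕ c) mod p            ≡⟨ mod-+ (toℕ a * toℕ b) _ ⟩
      a *ₚ b +ₚ a *ₚ c                                ∎

  +-*-commutativeRing : CommutativeRing 0ℓ 0ℓ
  +-*-commutativeRing = record
    { Carrier = Fin p
    ; _≈_ = _≡_
    ; _+_ = _+ₚ_
    ; _*_ = _*ₚ_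
    ; -_ = negₚ
    ; 0# = 0ₚ
    ; 1# = 1ₚ
    ; isCommutativeRing = record
      { isRing = record
        { +-isAbelianGroup = record
          { isGroup = record
            { isMonoid = record
              { isSemigroup = record
                { isMagma = record { isEquivalence = isEquivalence ; ∙-cong = cong₂ _+ₚ_ }
                ; assoc = +ₚ-assoc }
              ; identity = comm∧idʳ⇒id +ₚ-comm +ₚ-identityʳ }
            ; inverse = comm∧invʳ⇒inv +ₚ-comm +ₚ-inverseʳ
            ; ⁻¹-cong = cong negₚ }
          ; comm = +ₚ-comm }
        ; *-cong = cong₂ _*ₚ_
        ; *-assoc = *ₚ-assoc
        ; *-identity = comm∧idʳ⇒id *ₚ-comm *ₚ-identityʳ
        ; distrib = *ₚ-distribˡ-+ₚ , comm∧distrˡ⇒distrʳ *ₚ-comm *ₚ-distribˡ-+ₚ }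
      ; *-comm = *ₚ-comm } }

  open CommutativeRing +-*-commutativeRing public
    using (+-abelianGroup; +-comm; zeroʳ; *-identityʳ; *-assoc; *-comm; +-identityʳ; -‿inverseʳ)
  open AbelianGroupProperties +-abelianGroup public
  open import Algebra.Properties.Ring (CommutativeRing.ring +-*-commutativeRing) public
    using (x[y-z]≈xy-xz; -‿distribʳ-*)

  *ₚ-mod : ∀ a m → a *ₚ (m mod p) ≡ (toℕ a * m) mod p
  *ₚ-mod a m = trans (cong (_*ₚ (m mod p)) (sym (mod-toℕ a))) (sym (mod-* (toℕ a) m))

  toℕ≢0 : ∀ {a} → a ≢ 0ₚ → toℕ a ≢ 0
  toℕ≢0 {a} a≢0 ta≡0 = a≢0 (trans (sym (mod-toℕ a)) (cong (_mod p) ta≡0))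

  *ₚ-inverse : Prime p → ∀ a → a ≢ 0ₚ → ∃ λ b → a *ₚ b ≡ 1ₚ
  *ₚ-inverse p-prime a a≢0 with coprime-Bézout (prime⇒coprime p-prime {{ℕ.≢-nonZero (toℕ≢0 a≢0)}} (toℕ<n a))
  ... | Bézout.-+ x y 1+xp≡ya = y mod p , (begin
    a *ₚ (y mod p)       ≡⟨ *ₚ-mod a y ⟩
    (toℕ a * y) mod p     ≡⟨ cong (_mod p) (trans (ℕ.*-comm (toℕ a) y) (sym 1+xp≡ya)) ⟩
    (1 + x * p) mod p     ≡⟨ mod-cong ([m+kn]%n≡m%n 1 x p) ⟩
    1ₚ                   ∎)
    where open ≡-Reasoning
  ... | Bézout.+- x y 1+ya≡xp = negₚ (y mod p) , (begin
    a *ₚ negₚ (y mod p)    ≡⟨ -‿distribʳ-* a (y mod p) ⟨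
    negₚ (a *ₚ (y mod p))  ≡⟨ cong negₚ (inverseʳ-unique 1ₚ _ 1+ay≡0) ⟩
    negₚ (negₚ 1ₚ)          ≡⟨ ⁻¹-involutive 1ₚ ⟩
    1ₚ                     ∎)
    where
    open ≡-Reasoning
    1+ay≡0 : 1ₚ +ₚ a *ₚ (y mod p) ≡ 0ₚ
    1+ay≡0 = begin
      1ₚ +ₚ a *ₚ (y mod p)              ≡⟨ cong (1ₚ +ₚ_) (*ₚ-mod a y) ⟩
      (1 mod p) +ₚ ((toℕ a * y) mod p)  ≡⟨ mod-+ 1 (toℕ a * y) ⟨
      (1 + toℕ a * y) mod p             ≡⟨ cong (λ m → (1 + m) mod p) (ℕ.*-comm (toℕ a) y) ⟩
      (1 + y * toℕ a) mod p             ≡⟨ cong (_mod p) 1+ya≡xp ⟩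
      (x * p) mod p                     ≡⟨ mod-≡0 (m*n%n≡0 x p) ⟩
      0ₚ                                ∎

  sum-translate : ∀ c (h : Fin p → ℕ) → sum (λ t → h (c +ₚ t)) ≡ sum h
  sum-translate c h = sum-bijection h (c +ₚ_) (_-ₚ c)
    (λ t → trans (cong (_-ₚ c) (+-comm c t)) (//-rightDividesʳ c t))
    (λ t → trans (+-comm c (t -ₚ c)) (//-rightDividesˡ c t))

  sum-dilate : Prime p → ∀ b → b ≢ 0ₚ → (h : Fin p → ℕ) → sum (λ a → h (a *ₚ b)) ≡ sum h
  sum-dilate p-prime b b≢0 h with *ₚ-inverse p-prime b b≢0
  ... | b⁻¹ , bb⁻¹≡1 = sum-bijection h (_*ₚ b) (_*ₚ b⁻¹)
    (λ a → trans (*-assoc a b b⁻¹) (trans (cong (a *ₚ_) bb⁻¹≡1) (*-identityʳ a)))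
    (λ a → trans (*-assoc a b⁻¹ b) (trans (cong (a *ₚ_) (trans (*-comm b⁻¹ b) bb⁻¹≡1)) (*-identityʳ a)))

module Vectors (p : ℕ) .{{_ : NonZero p}} where

  open ZMod p

  infixl 6 _-ᵥ_
  infix 4 _≟ᵥ_

  _-ᵥ_ : ∀ {n} → Vec (Fin p) n → Vec (Fin p) n → Vec (Fin p) n
  _-ᵥ_ = subV p

  ⟨_,_⟩ : ∀ {n} → Vec (Fin p) n → Vec (Fin p) n → Fin p
  ⟨_,_⟩ = inner p

  0ᵥ : ∀ {n} → Vec (Fin p) n
  0ᵥ {n} = zeroV p n

  _≟ᵥ_ : ∀ {n} → DecidableEquality (Vec (Fin p) n)
  _≟ᵥ_ = ≡-dec _≟ₚ_

  isZeroV≡does : ∀ {n} (v : Vec (Fin p) n) → isZeroV p v ≡ does (v ≟ᵥ 0ᵥ)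
  isZeroV≡does []      = refl
  isZeroV≡does (a ∷ v) = cong (does (a ≟ₚ 0ₚ) ∧_) (isZeroV≡does v)

  isZeroV-true⇒≡0ᵥ : ∀ {n} (v : Vec (Fin p) n) → isZeroV p v ≡ true → v ≡ 0ᵥ
  isZeroV-true⇒≡0ᵥ v isZero with v ≟ᵥ 0ᵥ | isZeroV≡does v
  ... | yes v≡0 | _          = v≡0
  ... | no  _   | notZero = contradiction (trans (sym isZero) notZero) λ ()

  x-ᵥ0≡x : ∀ {n} (x : Vec (Fin p) n) → x -ᵥ 0ᵥ ≡ x
  x-ᵥ0≡x []      = refl
  x-ᵥ0≡x (a ∷ x) = cong₂ _∷_ (trans (cong (a +ₚ_) ε⁻¹≈ε) (+-identityʳ a)) (x-ᵥ0≡x x)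

  x-ᵥ[x-ᵥy]≡y : ∀ {n} (x y : Vec (Fin p) n) → x -ᵥ (x -ᵥ y) ≡ y
  x-ᵥ[x-ᵥy]≡y []      []      = refl
  x-ᵥ[x-ᵥy]≡y (a ∷ x) (b ∷ y) = cong₂ _∷_ (x-[x-y]≈y a b) (x-ᵥ[x-ᵥy]≡y x y)

  [x-ᵥy]-ᵥz≡-[y-ᵥ[x-ᵥz]] : ∀ {n} (x y z : Vec (Fin p) n) → (x -ᵥ y) -ᵥ z ≡ negV p (y -ᵥ (x -ᵥ z))
  [x-ᵥy]-ᵥz≡-[y-ᵥ[x-ᵥz]] []      []      []      = refl
  [x-ᵥy]-ᵥz≡-[y-ᵥ[x-ᵥz]] (a ∷ x) (b ∷ y) (c ∷ z) =
    cong₂ _∷_ (trans ([x-y]-z≈[x-z]-y a b c) (sym (⁻¹-anti-homo‿- b (a -ₚ c)))) ([x-ᵥy]-ᵥz≡-[y-ᵥ[x-ᵥz]] x y z)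

  x-ᵥy≡0⇒x≡y : ∀ {n} (x y : Vec (Fin p) n) → x -ᵥ y ≡ 0ᵥ → x ≡ y
  x-ᵥy≡0⇒x≡y []      []      _     = refl
  x-ᵥy≡0⇒x≡y (a ∷ x) (b ∷ y) a∷x-b∷y≡0 =
    cong₂ _∷_ (x∙y⁻¹≈ε⇒x≈y a b (∷-injectiveˡ a∷x-b∷y≡0)) (x-ᵥy≡0⇒x≡y x y (∷-injectiveʳ a∷x-b∷y≡0))

  ⟨x,0⟩≡0 : ∀ {n} (x : Vec (Fin p) n) → ⟨ x , 0ᵥ ⟩ ≡ 0ₚ
  ⟨x,0⟩≡0 []      = refl
  ⟨x,0⟩≡0 (a ∷ x) = trans (cong₂ _+ₚ_ (zeroʳ a) (⟨x,0⟩≡0 x)) (+-identityʳ 0ₚ)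

  ⟨x,y-z⟩≡⟨x,y⟩-⟨x,z⟩ : ∀ {n} (x y z : Vec (Fin p) n) → ⟨ x , y -ᵥ z ⟩ ≡ ⟨ x , y ⟩ -ₚ ⟨ x , z ⟩
  ⟨x,y-z⟩≡⟨x,y⟩-⟨x,z⟩ []      []      []      = sym (-‿inverseʳ 0ₚ)
  ⟨x,y-z⟩≡⟨x,y⟩-⟨x,z⟩ (a ∷ x) (b ∷ y) (c ∷ z) = begin
    a *ₚ (b -ₚ c) +ₚ ⟨ x , y -ᵥ z ⟩                     ≡⟨ cong₂ _+ₚ_ (x[y-z]≈xy-xz a b c) (⟨x,y-z⟩≡⟨x,y⟩-⟨x,z⟩ x y z) ⟩
    (a *ₚ b -ₚ a *ₚ c) +ₚ (⟨ x , y ⟩ -ₚ ⟨ x , z ⟩)      ≡⟨ [w∙x]-[y∙z]≈[w-y]∙[x-z] (a *ₚ b) ⟨ x , y ⟩ (a *ₚ c) ⟨ x , z ⟩ ⟨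
    (a *ₚ b +ₚ ⟨ x , y ⟩) -ₚ (a *ₚ c +ₚ ⟨ x , z ⟩)      ∎
    where open ≡-Reasoning

  ∑ᵥ : ∀ {n} → (Vec (Fin p) n → ℕ) → ℕ
  ∑ᵥ {zero}  g = g []
  ∑ᵥ {suc n} g = sum (λ a → ∑ᵥ (λ v → g (a ∷ v)))

  ∑ᵥ-cong : ∀ {n} {g h : Vec (Fin p) n → ℕ} → (∀ v → g v ≡ h v) → ∑ᵥ g ≡ ∑ᵥ h
  ∑ᵥ-cong {zero}  g≗h = g≗h []
  ∑ᵥ-cong {suc n} g≗h = sum-cong-≗ (λ a → ∑ᵥ-cong (λ v → g≗h (a ∷ v)))

  ∑ᵥ-distrib-+ : ∀ {n} (g h : Vec (Fin p) n → ℕ) → ∑ᵥ (λ v → g v + h v) ≡ ∑ᵥ g + ∑ᵥ h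
  ∑ᵥ-distrib-+ {zero}  g h = refl
  ∑ᵥ-distrib-+ {suc n} g h = trans (sum-cong-≗ λ a → ∑ᵥ-distrib-+ (g ∘ (a ∷_)) (h ∘ (a ∷_)))
                                   (∑-distrib-+ (λ a → ∑ᵥ (g ∘ (a ∷_))) (λ a → ∑ᵥ (h ∘ (a ∷_))))

  *-distribˡ-∑ᵥ : ∀ {n} c (g : Vec (Fin p) n → ℕ) → c * ∑ᵥ g ≡ ∑ᵥ (λ v → c * g v)
  *-distribˡ-∑ᵥ {zero}  c g = refl
  *-distribˡ-∑ᵥ {suc n} c g = trans (*-distribˡ-sum c (λ a → ∑ᵥ (g ∘ (a ∷_))))
                                    (sum-cong-≗ λ a → *-distribˡ-∑ᵥ c (g ∘ (a ∷_)))

  ∑ᵥ-const : ∀ n c → ∑ᵥ {n} (λ _ → c) ≡ p ^ n * c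
  ∑ᵥ-const zero    c = sym (ℕ.+-identityʳ c)
  ∑ᵥ-const (suc n) c = begin
    sum {p} (λ _ → ∑ᵥ {n} (λ _ → c))   ≡⟨ sum-cong-≗ {p} (λ _ → ∑ᵥ-const n c) ⟩
    sum {p} (λ _ → p ^ n * c)          ≡⟨ sum-const p (p ^ n * c) ⟩
    p * (p ^ n * c)                    ≡⟨ ℕ.*-assoc p (p ^ n) c ⟨
    p ^ suc n * c                      ∎
    where open ≡-Reasoning

  ∑ᵥ-sum-comm : ∀ {n q} (g : Vec (Fin p) n → Fin q → ℕ) →
    ∑ᵥ (λ v → sum (g v)) ≡ sum (λ i → ∑ᵥ (λ v → g v i))
  ∑ᵥ-sum-comm {zero}  g = refl
  ∑ᵥ-sum-comm {suc n} g = trans (sum-cong-≗ λ a → ∑ᵥ-sum-comm (g ∘ (a ∷_)))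
                                (∑-comm (λ a i → ∑ᵥ (λ v → g (a ∷ v) i)))

  ∑ᵥ-comm : ∀ {n m} (g : Vec (Fin p) n → Vec (Fin p) m → ℕ) →
    ∑ᵥ (λ v → ∑ᵥ (g v)) ≡ ∑ᵥ (λ u → ∑ᵥ (λ v → g v u))
  ∑ᵥ-comm {zero}  g = refl
  ∑ᵥ-comm {suc n} g = trans (sum-cong-≗ λ a → ∑ᵥ-comm (g ∘ (a ∷_)))
                            (sym (∑ᵥ-sum-comm (λ u a → ∑ᵥ (λ v → g (a ∷ v) u))))

  ∑ᵥ-reflect : ∀ {n} (t : Vec (Fin p) n) (g : Vec (Fin p) n → ℕ) → ∑ᵥ (λ v → g (t -ᵥ v)) ≡ ∑ᵥ g
  ∑ᵥ-reflect []      g = refl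
  ∑ᵥ-reflect (b ∷ t) g = trans (sum-cong-≗ λ a → ∑ᵥ-reflect t (λ v → g ((b -ₚ a) ∷ v)))
    (sum-bijection (λ a → ∑ᵥ (g ∘ (a ∷_))) (b -ₚ_) (b -ₚ_) (x-[x-y]≈y b) (x-[x-y]≈y b))

  ∑ᵥ-indicator : ∀ {n} (h : Vec (Fin p) n → ℕ) (c : Vec (Fin p) n) →
    ∑ᵥ (λ v → 𝟙 (does (v ≟ᵥ c)) * h v) ≡ h c
  ∑ᵥ-indicator h []      = ℕ.+-identityʳ (h [])
  ∑ᵥ-indicator {suc n} h (b ∷ c) = begin
    sum (λ a → ∑ᵥ (λ v → 𝟙 (does (a ≟ₚ b) ∧ does (v ≟ᵥ c)) * h (a ∷ v)))
      ≡⟨ sum-cong-≗ (λ a → ∑ᵥ-cong λ v → trans (cong (_* h (a ∷ v)) (𝟙-∧ (does (a ≟ₚ b)) (does (v ≟ᵥ c))))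
                                                (ℕ.*-assoc (𝟙 (does (a ≟ₚ b))) (𝟙 (does (v ≟ᵥ c))) (h (a ∷ v)))) ⟩
    sum (λ a → ∑ᵥ (λ v → 𝟙 (does (a ≟ₚ b)) * (𝟙 (does (v ≟ᵥ c)) * h (a ∷ v))))
      ≡⟨ sum-cong-≗ (λ a → sym (*-distribˡ-∑ᵥ {n} (𝟙 (does (a ≟ₚ b))) _)) ⟩
    sum (λ a → 𝟙 (does (a ≟ₚ b)) * ∑ᵥ (λ v → 𝟙 (does (v ≟ᵥ c)) * h (a ∷ v)))
      ≡⟨ sum-cong-≗ (λ a → cong (𝟙 (does (a ≟ₚ b)) *_) (∑ᵥ-indicator (h ∘ (a ∷_)) c)) ⟩
    sum (λ a → 𝟙 (does (a ≟ₚ b)) * h (a ∷ c))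
      ≡⟨ sum-indicator _≟ₚ_ (λ a → h (a ∷ c)) b ⟩
    h (b ∷ c) ∎
    where open ≡-Reasoning

  count-allV : ∀ n (P : Vec (Fin p) n → Bool) → count P (allV p n) ≡ ∑ᵥ (𝟙 ∘ P)
  count-allV zero    P with P []
  ... | true  = refl
  ... | false = refl
  count-allV (suc n) P = trans (count-concatMap-tabulate P (λ a → List.map (a ∷_) (allV p n)) id)
    (sum-cong-≗ λ a → trans (count-map P (a ∷_) (allV p n)) (count-allV n (P ∘ (a ∷_))))

  sumUpTo-∑ᵥ : ∀ m {n} (g : ℕ → Vec (Fin p) n → ℕ) →
    sumUpTo m (λ k → ∑ᵥ (g k)) ≡ ∑ᵥ (λ v → sumUpTo m (λ k → g k v))
  sumUpTo-∑ᵥ zero    g = refl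
  sumUpTo-∑ᵥ (suc m) g = trans (cong (_+ ∑ᵥ (g (suc m))) (sumUpTo-∑ᵥ m g))
                               (sym (∑ᵥ-distrib-+ (λ v → sumUpTo m (λ k → g k v)) (g (suc m))))

  ∑ᵥ-inner : Prime p → ∀ {n} (u : Vec (Fin p) n) → u ≢ 0ᵥ → (h : Fin p → ℕ) →
    p * ∑ᵥ (λ x → h ⟨ x , u ⟩) ≡ p ^ n * sum h
  ∑ᵥ-inner p-prime [] []≢0 h = contradiction refl []≢0
  ∑ᵥ-inner p-prime {suc n} (b ∷ u) b∷u≢0 h with u ≟ᵥ 0ᵥ
  ... | no u≢0 = begin
    p * sum (λ a → ∑ᵥ (λ x → h (a *ₚ b +ₚ ⟨ x , u ⟩)))    ≡⟨ *-distribˡ-sum p (λ a → ∑ᵥ {n} (λ x → h (a *ₚ b +ₚ ⟨ x , u ⟩))) ⟩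
    sum (λ a → p * ∑ᵥ (λ x → h (a *ₚ b +ₚ ⟨ x , u ⟩)))    ≡⟨ sum-cong-≗ (λ a → ∑ᵥ-inner p-prime u u≢0 (λ t → h (a *ₚ b +ₚ t))) ⟩
    sum (λ a → p ^ n * sum (λ t → h (a *ₚ b +ₚ t)))      ≡⟨ sum-cong-≗ (λ a → cong (p ^ n *_) (sum-translate (a *ₚ b) h)) ⟩
    sum {p} (λ a → p ^ n * sum h)                        ≡⟨ sum-const p (p ^ n * sum h) ⟩
    p * (p ^ n * sum h)                                  ≡⟨ ℕ.*-assoc p (p ^ n) (sum h) ⟨
    p ^ suc n * sum h                                    ∎
    where open ≡-Reasoning
  ... | yes refl = begin
    p * sum (λ a → ∑ᵥ {n} (λ x → h (a *ₚ b +ₚ ⟨ x , 0ᵥ ⟩)))  ≡⟨ cong (p *_) (sum-cong-≗ λ a → ∑ᵥ-cong {n} λ x → cong h (trans (cong (a *ₚ b +ₚ_) (⟨x,0⟩≡0 x)) (+-identityʳ _))) ⟩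
    p * sum (λ a → ∑ᵥ {n} (λ _ → h (a *ₚ b)))            ≡⟨ cong (p *_) (sum-cong-≗ λ a → ∑ᵥ-const n (h (a *ₚ b))) ⟩
    p * sum (λ a → p ^ n * h (a *ₚ b))                  ≡⟨ cong (p *_) (*-distribˡ-sum (p ^ n) (λ a → h (a *ₚ b))) ⟨
    p * (p ^ n * sum (λ a → h (a *ₚ b)))                ≡⟨ cong (λ s → p * (p ^ n * s)) (sum-dilate p-prime b b≢0 h) ⟩
    p * (p ^ n * sum h)                                 ≡⟨ ℕ.*-assoc p (p ^ n) (sum h) ⟨
    p ^ suc n * sum h                                   ∎
    where
    open ≡-Reasoning
    b≢0 : b ≢ 0ₚ
    b≢0 b≡0 = b∷u≢0 (cong (_∷ 0ᵥ) b≡0)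

  𝟙[_≢_] : ∀ {n} → Vec (Fin p) n → Vec (Fin p) n → ℕ
  𝟙[ v ≢ c ] with v ≟ᵥ c
  ... | yes _ = 0
  ... | no  _ = 1

  𝟙[≢]-≢ : ∀ {n} {v c : Vec (Fin p) n} → v ≢ c → 𝟙[ v ≢ c ] ≡ 1
  𝟙[≢]-≢ {v = v} {c} v≢c with v ≟ᵥ c
  ... | yes v≡c = contradiction v≡c v≢c
  ... | no  _   = refl

  𝟙[≢]-guard : ∀ {n} (v c : Vec (Fin p) n) {a b} → (v ≢ c → a ≡ b) → 𝟙[ v ≢ c ] * a ≡ 𝟙[ v ≢ c ] * b
  𝟙[≢]-guard v c a≡b with v ≟ᵥ c
  ... | yes _   = refl
  ... | no  v≢c = cong (1 *_) (a≡b v≢c)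

  𝟙-split : ∀ {n} (v c : Vec (Fin p) n) m → m ≡ 𝟙 (does (v ≟ᵥ c)) * m + 𝟙[ v ≢ c ] * m
  𝟙-split v c m with v ≟ᵥ c
  ... | yes _ = sym (trans (ℕ.+-identityʳ (m + 0)) (ℕ.+-identityʳ m))
  ... | no  _ = sym (ℕ.+-identityʳ m)

  ∑ᵥ-split : ∀ {n} (h : Vec (Fin p) n → ℕ) c → ∑ᵥ h ≡ h c + ∑ᵥ (λ v → 𝟙[ v ≢ c ] * h v)
  ∑ᵥ-split {n} h c = begin
    ∑ᵥ h                                                              ≡⟨ ∑ᵥ-cong (λ v → 𝟙-split v c (h v)) ⟩
    ∑ᵥ (λ v → 𝟙 (does (v ≟ᵥ c)) * h v + 𝟙[ v ≢ c ] * h v)             ≡⟨ ∑ᵥ-distrib-+ {n} _ _ ⟩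
    ∑ᵥ (λ v → 𝟙 (does (v ≟ᵥ c)) * h v) + ∑ᵥ (λ v → 𝟙[ v ≢ c ] * h v)  ≡⟨ cong (_+ ∑ᵥ (λ v → 𝟙[ v ≢ c ] * h v)) (∑ᵥ-indicator h c) ⟩
    h c + ∑ᵥ (λ v → 𝟙[ v ≢ c ] * h v)                                 ∎
    where open ≡-Reasoning

module Spectrum (p : ℕ) .{{_ : NonZero p}} {n : ℕ} (f : Vec (Fin p) n → Fin p) where

  open ZMod p
  open Vectors p

  fibre : (Vec (Fin p) n → Fin p) → Fin p → ℕ
  fibre g c = ∑ᵥ (λ v → 𝟙 (does (g v ≟ₚ c)))

  Δ : Vec (Fin p) n → Vec (Fin p) n → Fin p
  Δ w a = f a -ₚ f (a -ᵥ w)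

  walshExponent : Vec (Fin p) n → Vec (Fin p) n → Fin p
  walshExponent x y = f y -ₚ ⟨ x , y ⟩

  fibre-total : ∀ g → sum (fibre g) ≡ p ^ n
  fibre-total g = begin
    sum (λ c → ∑ᵥ (λ v → 𝟙 (does (g v ≟ₚ c))))   ≡⟨ ∑ᵥ-sum-comm (λ v c → 𝟙 (does (g v ≟ₚ c))) ⟨
    ∑ᵥ (λ v → sum (λ c → 𝟙 (does (g v ≟ₚ c))))   ≡⟨ ∑ᵥ-cong (λ v → sum-cong-≗ λ c → trans (cong 𝟙 (does-≟ₚ-sym (g v) c)) (sym (ℕ.*-identityʳ _))) ⟩
    ∑ᵥ (λ v → sum (λ c → 𝟙 (does (c ≟ₚ g v)) * 1)) ≡⟨ ∑ᵥ-cong (λ v → sum-indicator _≟ₚ_ (λ _ → 1) (g v)) ⟩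
    ∑ᵥ {n} (λ _ → 1)                              ≡⟨ ∑ᵥ-const n 1 ⟩
    p ^ n * 1                                     ≡⟨ ℕ.*-identityʳ (p ^ n) ⟩
    p ^ n                                         ∎
    where open ≡-Reasoning

  fibre-complete : ∀ g c₀ k → (∀ c → c ≢ c₀ → fibre g c ≡ k) → p ^ n ≡ p * k → ∀ c → fibre g c ≡ k
  fibre-complete g c₀ k others p^n≡p*k c with c ≟ₚ c₀
  ... | no  c≢c₀ = others c c≢c₀
  ... | yes refl = sum-except⇒≡ p (fibre g) c k others (trans (fibre-total g) p^n≡p*k)

  W-coefficient : ∀ x c → W p f x c ≡ ℤ.+ fibre (walshExponent x) c
  W-coefficient x c = cong ℤ.+_ (count-allV n (λ y → does (walshExponent x y ≟ₚ c)))

  sumℤ-tabulate : ∀ {q} (t : Fin q → Fin p) (z : Fin p → ℤ) (k : Fin p → ℕ) → (∀ c → z c ≡ ℤ.+ k c) →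
    sumℤ p (List.map z (tabulate t)) ≡ ℤ.+ sum (k ∘ t)
  sumℤ-tabulate {zero}  t z k z≡k = refl
  sumℤ-tabulate {suc q} t z k z≡k = cong₂ _+ℤ_ (z≡k (t fzero)) (sumℤ-tabulate (t ∘ fsuc) z k z≡k)

  walsh-difference : ∀ x w y → walshExponent x y -ₚ walshExponent x (y -ᵥ w) ≡ Δ w y -ₚ ⟨ x , w ⟩
  walsh-difference x w y = begin
    (f y -ₚ ⟨ x , y ⟩) -ₚ (f (y -ᵥ w) -ₚ ⟨ x , y -ᵥ w ⟩)   ≡⟨ [w-x]-[y-z]≈[w-y]-[x-z] (f y) ⟨ x , y ⟩ (f (y -ᵥ w)) ⟨ x , y -ᵥ w ⟩ ⟩
    Δ w y -ₚ (⟨ x , y ⟩ -ₚ ⟨ x , y -ᵥ w ⟩)                ≡⟨ cong (Δ w y -ₚ_) (⟨x,y-z⟩≡⟨x,y⟩-⟨x,z⟩ x y (y -ᵥ w)) ⟨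
    Δ w y -ₚ ⟨ x , y -ᵥ (y -ᵥ w) ⟩                         ≡⟨ cong (λ v → Δ w y -ₚ ⟨ x , v ⟩) (x-ᵥ[x-ᵥy]≡y y w) ⟩
    Δ w y -ₚ ⟨ x , w ⟩                                    ∎
    where open ≡-Reasoning

  walsh-pair⇔Δ : ∀ x e w y →
    walshExponent x (y -ᵥ w) ≡ negₚ (e -ₚ walshExponent x y) ⇔ Δ w y ≡ e +ₚ ⟨ x , w ⟩
  walsh-pair⇔Δ x e w y = begin
    g (y -ᵥ w) ≡ negₚ (e -ₚ g y)     ∼⟨ mk⇔ (λ eq → trans eq (⁻¹-anti-homo‿- e (g y))) (λ eq → trans eq (sym (⁻¹-anti-homo‿- e (g y)))) ⟩
    g (y -ᵥ w) ≡ g y -ₚ e            ∼⟨ mk⇔ sym sym ⟩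
    g y -ₚ e ≡ g (y -ᵥ w)            ∼⟨ x-y≈z⇔x-z≈y ⟩
    g y -ₚ g (y -ᵥ w) ≡ e            ∼⟨ mk⇔ (trans (sym (walsh-difference x w y))) (trans (walsh-difference x w y)) ⟩
    Δ w y -ₚ ⟨ x , w ⟩ ≡ e           ∼⟨ x-y≈z⇔x≈z∙y ⟩
    Δ w y ≡ e +ₚ ⟨ x , w ⟩           ∎
    where
    open Related.EquationalReasoning {k = equivalence}
    g : Vec (Fin p) n → Fin p
    g = walshExponent x

  powerSpectrum≡autocorrelation : ∀ x e →
    _*C_ p (W p f x) (conjC p (W p f x)) e ≡ ℤ.+ ∑ᵥ (λ w → fibre (Δ w) (e +ₚ ⟨ x , w ⟩))
  powerSpectrum≡autocorrelation x e = trans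
    (sumℤ-tabulate id _ (λ c → F c * B c)
      (λ c → trans (cong₂ _*ℤ_ (W-coefficient x c) (W-coefficient x _)) (sym (ℤ.pos-* (F c) (B c)))))
    (cong ℤ.+_ (begin
      sum (λ c → F c * B c)
        ≡⟨ sum-cong-≗ (λ c → trans (ℕ.*-comm (F c) (B c)) (*-distribˡ-∑ᵥ (B c) (λ y → 𝟙 (does (g y ≟ₚ c))))) ⟩
      sum (λ c → ∑ᵥ (λ y → B c * 𝟙 (does (g y ≟ₚ c))))
        ≡⟨ ∑ᵥ-sum-comm (λ y c → B c * 𝟙 (does (g y ≟ₚ c))) ⟨
      ∑ᵥ (λ y → sum (λ c → B c * 𝟙 (does (g y ≟ₚ c))))
        ≡⟨ ∑ᵥ-cong (λ y → sum-cong-≗ λ c → trans (ℕ.*-comm (B c) _) (cong (λ b → 𝟙 b * B c) (does-≟ₚ-sym (g y) c))) ⟩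
      ∑ᵥ (λ y → sum (λ c → 𝟙 (does (c ≟ₚ g y)) * B c))
        ≡⟨ ∑ᵥ-cong (λ y → sum-indicator _≟ₚ_ B (g y)) ⟩
      ∑ᵥ (λ y → B (g y))
        ≡⟨ ∑ᵥ-cong (λ y → ∑ᵥ-reflect y (λ y′ → 𝟙 (does (g y′ ≟ₚ negₚ (e -ₚ g y))))) ⟨
      ∑ᵥ (λ y → ∑ᵥ (λ w → 𝟙 (does (g (y -ᵥ w) ≟ₚ negₚ (e -ₚ g y)))))
        ≡⟨ ∑ᵥ-comm (λ y w → 𝟙 (does (g (y -ᵥ w) ≟ₚ negₚ (e -ₚ g y)))) ⟩
      ∑ᵥ (λ w → ∑ᵥ (λ y → 𝟙 (does (g (y -ᵥ w) ≟ₚ negₚ (e -ₚ g y)))))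
        ≡⟨ ∑ᵥ-cong (λ w → ∑ᵥ-cong λ y → cong 𝟙 (does-⇔ (walsh-pair⇔Δ x e w y) (g (y -ᵥ w) ≟ₚ negₚ (e -ₚ g y)) (Δ w y ≟ₚ e +ₚ ⟨ x , w ⟩))) ⟩
      ∑ᵥ (λ w → fibre (Δ w) (e +ₚ ⟨ x , w ⟩))
        ∎))
    where
    open ≡-Reasoning
    g : Vec (Fin p) n → Fin p
    g = walshExponent x
    F : Fin p → ℕ
    F = fibre g
    B : Fin p → ℕ
    B c = F (negₚ (e -ₚ c))

  offDiagonal : Vec (Fin p) n → Fin p → ℕ
  offDiagonal x e = ∑ᵥ (λ w → 𝟙[ w ≢ 0ᵥ ] * fibre (Δ w) (e +ₚ ⟨ x , w ⟩))

  fibre-Δ0 : ∀ c → fibre (Δ 0ᵥ) c ≡ p ^ n * 𝟙 (does (0ₚ ≟ₚ c))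
  fibre-Δ0 c = trans (∑ᵥ-cong (λ a → cong (λ d → 𝟙 (does (d ≟ₚ c))) (Δ0≡0 a))) (∑ᵥ-const n _)
    where
    Δ0≡0 : ∀ a → Δ 0ᵥ a ≡ 0ₚ
    Δ0≡0 a = trans (cong (λ v → f a -ₚ f v) (x-ᵥ0≡x a)) (-‿inverseʳ (f a))

  constC-𝟙 : ∀ m c → ℤ.+ (m * 𝟙 (does (0ₚ ≟ₚ c))) ≡ constC p m c
  constC-𝟙 m c = trans (cong (λ k → ℤ.+ (m * 𝟙 (k ℕ.≡ᵇ toℕ c))) toℕ-0ₚ) (at (toℕ c))
    where
    at : ∀ k → ℤ.+ (m * 𝟙 (0 ℕ.≡ᵇ k)) ≡ (if k ℕ.≡ᵇ 0 then ℤ.+ m else ℤ.+ 0)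
    at zero    = cong ℤ.+_ (ℕ.*-identityʳ m)
    at (suc _) = cong ℤ.+_ (ℕ.*-zeroʳ m)

  powerSpectrum-split : ∀ x e →
    _*C_ p (W p f x) (conjC p (W p f x)) e ≡ constC p (p ^ n) e +ℤ ℤ.+ offDiagonal x e
  powerSpectrum-split x e = begin
    _*C_ p (W p f x) (conjC p (W p f x)) e                         ≡⟨ powerSpectrum≡autocorrelation x e ⟩
    ℤ.+ ∑ᵥ (λ w → fibre (Δ w) (e +ₚ ⟨ x , w ⟩))                     ≡⟨ cong ℤ.+_ (∑ᵥ-split (λ w → fibre (Δ w) (e +ₚ ⟨ x , w ⟩)) 0ᵥ) ⟩
    ℤ.+ (fibre (Δ 0ᵥ) (e +ₚ ⟨ x , 0ᵥ ⟩) + offDiagonal x e)          ≡⟨ cong (λ c → ℤ.+ (fibre (Δ 0ᵥ) c + offDiagonal x e)) (trans (cong (e +ₚ_) (⟨x,0⟩≡0 x)) (+-identityʳ e)) ⟩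
    ℤ.+ (fibre (Δ 0ᵥ) e + offDiagonal x e)                          ≡⟨ cong (λ m → ℤ.+ (m + offDiagonal x e)) (fibre-Δ0 e) ⟩
    ℤ.+ (p ^ n * 𝟙 (does (0ₚ ≟ₚ e))) +ℤ ℤ.+ offDiagonal x e          ≡⟨ cong (_+ℤ ℤ.+ offDiagonal x e) (constC-𝟙 (p ^ n) e) ⟩
    constC p (p ^ n) e +ℤ ℤ.+ offDiagonal x e                       ∎
    where open ≡-Reasoning

  balanced⇒bent : ∀ k → (∀ w → w ≢ 0ᵥ → ∀ c → fibre (Δ w) c ≡ k) → Bent p f
  balanced⇒bent k balanced x = ℤ.+ ∑ᵥ {n} (λ w → 𝟙[ w ≢ 0ᵥ ] * k) , λ e →
    trans (powerSpectrum-split x e)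
          (cong (λ m → constC p (p ^ n) e +ℤ ℤ.+ m) (∑ᵥ-cong λ w → 𝟙[≢]-guard w 0ᵥ λ w≢0 → balanced w w≢0 _))

  bent⇒offDiagonal-constant : Bent p f → ∀ x e → offDiagonal x e ≡ offDiagonal x 0ₚ
  bent⇒offDiagonal-constant bent x e with bent x
  ... | c , spectrum≡ = ℤ.+-injective (trans (offDiagonal≡c e) (sym (offDiagonal≡c 0ₚ)))
    where
    offDiagonal≡c : ∀ e → ℤ.+ offDiagonal x e ≡ c
    offDiagonal≡c e = ℤ-AbelianGroup.∙-cancelˡ (constC p (p ^ n) e) _ _
      (trans (sym (powerSpectrum-split x e)) (spectrum≡ e))

  p^n≡p*p^[n∸1] : 1 ≤ n → p ^ n ≡ p * p ^ (n ∸ 1)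
  p^n≡p*p^[n∸1] (s≤s z≤n) = refl

  fibre-constant⇒≡p^[n∸1] : 1 ≤ n → ∀ g c₀ → (∀ c → fibre g c ≡ fibre g c₀) → ∀ c → fibre g c ≡ p ^ (n ∸ 1)
  fibre-constant⇒≡p^[n∸1] 1≤n g c₀ constant c = trans (constant c) (ℕ.*-cancelˡ-≡ _ _ p (begin
    p * fibre g c₀            ≡⟨ sum-const p (fibre g c₀) ⟨
    sum {p} (λ _ → fibre g c₀) ≡⟨ sum-cong-≗ constant ⟨
    sum (fibre g)             ≡⟨ fibre-total g ⟩
    p ^ n                     ≡⟨ p^n≡p*p^[n∸1] 1≤n ⟩
    p * p ^ (n ∸ 1)           ∎))
    where open ≡-Reasoning

  module BentDerivative (p-prime : Prime p) (bent : Bent p f) (w₀ : Vec (Fin p) n) (w₀≢0 : w₀ ≢ 0ᵥ) where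

    shifted : Vec (Fin p) n → Fin p → ℕ
    shifted w e = ∑ᵥ (λ x → fibre (Δ w) (e +ₚ ⟨ x , w -ᵥ w₀ ⟩))

    shifted-self : ∀ e → shifted w₀ e ≡ p ^ n * fibre (Δ w₀) e
    shifted-self e = trans (∑ᵥ-cong (λ x → cong (fibre (Δ w₀)) (e+⟨x,w₀-w₀⟩≡e x))) (∑ᵥ-const n _)
      where
      e+⟨x,w₀-w₀⟩≡e : ∀ x → e +ₚ ⟨ x , w₀ -ᵥ w₀ ⟩ ≡ e
      e+⟨x,w₀-w₀⟩≡e x = trans (cong (e +ₚ_) (trans (⟨x,y-z⟩≡⟨x,y⟩-⟨x,z⟩ x w₀ w₀) (-‿inverseʳ _))) (+-identityʳ e)

    p*shifted-other : ∀ w → w ≢ w₀ → ∀ e → p * shifted w e ≡ p ^ n * sum (fibre (Δ w))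
    p*shifted-other w w≢w₀ e = trans
      (∑ᵥ-inner p-prime (w -ᵥ w₀) (w≢w₀ ∘ x-ᵥy≡0⇒x≡y w w₀) (λ t → fibre (Δ w) (e +ₚ t)))
      (cong (p ^ n *_) (sum-translate e (fibre (Δ w))))

    averaged : Fin p → ℕ
    averaged e = ∑ᵥ (λ x → offDiagonal x (e -ₚ ⟨ x , w₀ ⟩))

    averaged-constant : ∀ e → averaged e ≡ averaged 0ₚ
    averaged-constant e = ∑ᵥ-cong λ x →
      trans (bent⇒offDiagonal-constant bent x _) (sym (bent⇒offDiagonal-constant bent x _))

    p*averaged : ∀ e → p * averaged e ≡ ∑ᵥ (λ w → 𝟙[ w ≢ 0ᵥ ] * (p * shifted w e))
    p*averaged e = begin
      p * ∑ᵥ (λ x → ∑ᵥ (λ w → 𝟙[ w ≢ 0ᵥ ] * fibre (Δ w) ((e -ₚ ⟨ x , w₀ ⟩) +ₚ ⟨ x , w ⟩)))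
        ≡⟨ cong (p *_) (∑ᵥ-comm (λ x w → 𝟙[ w ≢ 0ᵥ ] * fibre (Δ w) ((e -ₚ ⟨ x , w₀ ⟩) +ₚ ⟨ x , w ⟩))) ⟩
      p * ∑ᵥ (λ w → ∑ᵥ (λ x → 𝟙[ w ≢ 0ᵥ ] * fibre (Δ w) ((e -ₚ ⟨ x , w₀ ⟩) +ₚ ⟨ x , w ⟩)))
        ≡⟨ cong (p *_) (∑ᵥ-cong λ w → ∑ᵥ-cong λ x → cong (λ c → 𝟙[ w ≢ 0ᵥ ] * fibre (Δ w) c) (shift x w)) ⟩
      p * ∑ᵥ (λ w → ∑ᵥ (λ x → 𝟙[ w ≢ 0ᵥ ] * fibre (Δ w) (e +ₚ ⟨ x , w -ᵥ w₀ ⟩)))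
        ≡⟨ cong (p *_) (∑ᵥ-cong {n} λ w → sym (*-distribˡ-∑ᵥ {n} 𝟙[ w ≢ 0ᵥ ] _)) ⟩
      p * ∑ᵥ (λ w → 𝟙[ w ≢ 0ᵥ ] * shifted w e)
        ≡⟨ *-distribˡ-∑ᵥ {n} p _ ⟩
      ∑ᵥ (λ w → p * (𝟙[ w ≢ 0ᵥ ] * shifted w e))
        ≡⟨ ∑ᵥ-cong (λ w → ℕ-*.x∙yz≈y∙xz p 𝟙[ w ≢ 0ᵥ ] (shifted w e)) ⟩
      ∑ᵥ (λ w → 𝟙[ w ≢ 0ᵥ ] * (p * shifted w e))
        ∎
      where
      open ≡-Reasoning
      shift : ∀ x w → (e -ₚ ⟨ x , w₀ ⟩) +ₚ ⟨ x , w ⟩ ≡ e +ₚ ⟨ x , w -ᵥ w₀ ⟩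
      shift x w = trans (xy∙z≈x∙zy e (negₚ ⟨ x , w₀ ⟩) ⟨ x , w ⟩) (cong (e +ₚ_) (sym (⟨x,y-z⟩≡⟨x,y⟩-⟨x,z⟩ x w w₀)))

    rest : Fin p → ℕ
    rest e = ∑ᵥ (λ w → 𝟙[ w ≢ w₀ ] * (𝟙[ w ≢ 0ᵥ ] * (p * shifted w e)))

    rest-constant : ∀ e → rest e ≡ rest 0ₚ
    rest-constant e = ∑ᵥ-cong λ w → 𝟙[≢]-guard w w₀ λ w≢w₀ →
      cong (𝟙[ w ≢ 0ᵥ ] *_) (trans (p*shifted-other w w≢w₀ e) (sym (p*shifted-other w w≢w₀ 0ₚ)))

    p*averaged-split : ∀ e → p * averaged e ≡ p * (p ^ n * fibre (Δ w₀) e) + rest e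
    p*averaged-split e = begin
      p * averaged e                               ≡⟨ p*averaged e ⟩
      ∑ᵥ (λ w → 𝟙[ w ≢ 0ᵥ ] * (p * shifted w e))   ≡⟨ ∑ᵥ-split (λ w → 𝟙[ w ≢ 0ᵥ ] * (p * shifted w e)) w₀ ⟩
      𝟙[ w₀ ≢ 0ᵥ ] * (p * shifted w₀ e) + rest e   ≡⟨ cong (λ b → b * (p * shifted w₀ e) + rest e) (𝟙[≢]-≢ w₀≢0) ⟩
      1 * (p * shifted w₀ e) + rest e              ≡⟨ cong (_+ rest e) (ℕ.*-identityˡ _) ⟩
      p * shifted w₀ e + rest e                    ≡⟨ cong (λ m → p * m + rest e) (shifted-self e) ⟩
      p * (p ^ n * fibre (Δ w₀) e) + rest e        ∎
      where open ≡-Reasoning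

    fibre-constant : ∀ e → fibre (Δ w₀) e ≡ fibre (Δ w₀) 0ₚ
    fibre-constant e = ℕ.*-cancelˡ-≡ _ _ (p ^ n) {{ℕ.m^n≢0 p n}} (ℕ.*-cancelˡ-≡ _ _ p
      (ℕ.+-cancelʳ-≡ (rest 0ₚ) _ _ (begin
        p * (p ^ n * fibre (Δ w₀) e) + rest 0ₚ       ≡⟨ cong (p * (p ^ n * fibre (Δ w₀) e) +_) (rest-constant e) ⟨
        p * (p ^ n * fibre (Δ w₀) e) + rest e        ≡⟨ p*averaged-split e ⟨
        p * averaged e                               ≡⟨ cong (p *_) (averaged-constant e) ⟩
        p * averaged 0ₚ                              ≡⟨ p*averaged-split 0ₚ ⟩
        p * (p ^ n * fibre (Δ w₀) 0ₚ) + rest 0ₚ      ∎)))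
      where open ≡-Reasoning

  bent⇒balanced : Prime p → 1 ≤ n → Bent p f → ∀ w → w ≢ 0ᵥ → ∀ c → fibre (Δ w) c ≡ p ^ (n ∸ 1)
  bent⇒balanced p-prime 1≤n bent w w≢0 =
    fibre-constant⇒≡p^[n∸1] 1≤n (Δ w) 0ₚ (BentDerivative.fibre-constant p-prime bent w w≢0)

module Classes (p : ℕ) .{{_ : NonZero p}} {n : ℕ} (f : Vec (Fin p) n → Fin p) (f0≡0 : f (zeroV p n) ≡ 0F p) where

  open ZMod p
  open Vectors p
  open Spectrum p f

  classOf : Bool → ℕ → ℕ
  classOf z t = if z then 0 else if t ℕ.≡ᵇ 0 then p else t

  -- The index i ∈ {0, …, p} with v ∈ D_i.
  class : Vec (Fin p) n → ℕ
  class v = classOf (isZeroV p v) (toℕ (f v))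

  -- The left-hand side is inD p f k v unfolded, with z = isZeroV p v and t = toℕ (f v).
  ≡ᵇ-classOf : ∀ k z t → t < p → (z ≡ true → t ≡ 0) →
    (if k ℕ.≡ᵇ 0 then z else if k ℕ.≡ᵇ p then (t ℕ.≡ᵇ 0) ∧ not z else t ℕ.≡ᵇ k) ≡ (k ℕ.≡ᵇ classOf z t)
  ≡ᵇ-classOf zero    true  t       t<p z⇒t≡0 = refl
  ≡ᵇ-classOf (suc k) true  t       t<p z⇒t≡0 rewrite z⇒t≡0 refl with suc k ℕ.≡ᵇ p
  ... | true  = refl
  ... | false = refl
  ≡ᵇ-classOf zero    false zero    t<p z⇒t≡0 = sym (≡ᵇ-false (ℕ.≢-nonZero⁻¹ p ∘ sym))
  ≡ᵇ-classOf (suc k) false zero    t<p z⇒t≡0 with suc k ℕ.≡ᵇ p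
  ... | true  = refl
  ... | false = refl
  ≡ᵇ-classOf zero    false (suc t) t<p z⇒t≡0 = refl
  ≡ᵇ-classOf (suc k) false (suc t) t<p z⇒t≡0 with suc k ℕ.≡ᵇ p in k≡ᵇp
  ... | true  = sym (≡ᵇ-false λ k≡t → ℕ.<⇒≢ t<p (trans (sym k≡t) (ℕ.≡ᵇ⇒≡ (suc k) p (subst T (sym k≡ᵇp) _))))
  ... | false = ≡ᵇ-cong-⇔ {suc t} {suc k} (mk⇔ sym sym)

  isZeroV⇒toℕ-f≡0 : ∀ v → isZeroV p v ≡ true → toℕ (f v) ≡ 0
  isZeroV⇒toℕ-f≡0 v v≟0 = trans (cong (toℕ ∘ f) (isZeroV-true⇒≡0ᵥ v v≟0)) (trans (cong toℕ f0≡0) toℕ-0ₚ)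

  inD≡class : ∀ k v → inD p f k v ≡ (k ℕ.≡ᵇ class v)
  inD≡class k v = ≡ᵇ-classOf k (isZeroV p v) (toℕ (f v)) (toℕ<n (f v)) (isZeroV⇒toℕ-f≡0 v)

  class≤p : ∀ v → class v ≤ p
  class≤p v = bound (isZeroV p v) (toℕ (f v)) (toℕ<n (f v))
    where
    bound : ∀ z t → t < p → classOf z t ≤ p
    bound true  t       _   = z≤n
    bound false zero    _   = ℕ.≤-refl
    bound false (suc t) t<p = ℕ.<⇒≤ t<p

  toℕ-f≡class%p : ∀ v → toℕ (f v) ≡ class v % p
  toℕ-f≡class%p v = reduce (isZeroV p v) (toℕ (f v)) (toℕ<n (f v)) (isZeroV⇒toℕ-f≡0 v)
    where
    reduce : ∀ z t → t < p → (z ≡ true → t ≡ 0) → t ≡ classOf z t % p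
    reduce true  t       _   z⇒t≡0 = trans (z⇒t≡0 refl) (sym (m*n%n≡0 0 p))
    reduce false zero    _   _     = sym (n%n≡0 p)
    reduce false (suc t) t<p _     = sym (m<n⇒m%n≡m t<p)

  class≥1 : ∀ v → v ≢ 0ᵥ → 1 ≤ class v
  class≥1 v v≢0 = subst (λ z → 1 ≤ classOf z (toℕ (f v))) (sym isZero≡false) (positive (toℕ (f v)))
    where
    isZero≡false : isZeroV p v ≡ false
    isZero≡false = trans (isZeroV≡does v) (dec-false (v ≟ᵥ 0ᵥ) v≢0)
    positive : ∀ t → 1 ≤ classOf false t
    positive zero    = ℕ.>-nonZero⁻¹ p
    positive (suc t) = s≤s z≤n

  class-0ᵥ : class 0ᵥ ≡ 0
  class-0ᵥ = cong (λ z → classOf z (toℕ (f 0ᵥ))) (trans (isZeroV≡does (zeroV p n)) (dec-true (0ᵥ {n} ≟ᵥ 0ᵥ) refl))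

  related⇒≢0ᵥ : ∀ {i} x y → 1 ≤ i → R p f i x y → x -ᵥ y ≢ 0ᵥ
  related⇒≢0ᵥ {i} x y 1≤i xRy x-y≡0 = ℕ.<⇒≢ 1≤i (sym (begin
    i               ≡⟨ ℕ.≡ᵇ⇒≡ i (class (x -ᵥ y)) (subst T (inD≡class i (x -ᵥ y)) xRy) ⟩
    class (x -ᵥ y)  ≡⟨ cong class x-y≡0 ⟩
    class 0ᵥ        ≡⟨ class-0ᵥ ⟩
    0               ∎))
    where open ≡-Reasoning

  related-to-class : ∀ w → R p f (class w) w 0ᵥ
  related-to-class w = subst (λ u → T (inD p f (class w) u)) (sym (x-ᵥ0≡x w))
    (subst T (sym (inD≡class (class w) w)) (ℕ.≡⇒≡ᵇ (class w) (class w) refl))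

  f-difference⇔class : ∀ a b j → f a -ₚ f b ≡ j mod p ⇔ class a % p ≡ (j + class b) % p
  f-difference⇔class a b j = begin
    f a -ₚ f b ≡ j mod p                          ∼⟨ x-y≈z⇔x≈z∙y ⟩
    f a ≡ (j mod p) +ₚ f b                         ∼⟨ mk⇔ (cong toℕ) toℕ-injective ⟩
    toℕ (f a) ≡ toℕ ((j mod p) +ₚ f b)             ∼⟨ mk⇔ (λ eq → trans (sym fa≡) (trans eq fb≡)) (λ eq → trans fa≡ (trans eq (sym fb≡))) ⟩
    class a % p ≡ (j + class b) % p               ∎
    where
    open Related.EquationalReasoning {k = equivalence}
    fa≡ : toℕ (f a) ≡ class a % p
    fa≡ = toℕ-f≡class%p a
    fb≡ : toℕ ((j mod p) +ₚ f b) ≡ (j + class b) % p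
    fb≡ = trans (toℕ-mod _) $ trans (cong₂ (λ s t → (s + t) % p) (toℕ-mod j) (toℕ-f≡class%p b)) (sym (%-distribˡ-+ j (class b) p))

  intersection-pointwise : ∀ {j} → 0 < j → j < p → ∀ a b →
    sumUpTo p (λ k → 𝟙 (inD p f ((j + k) % p) a ∧ inD p f k b)) + 𝟙 (inD p f p a ∧ inD p f (p ∸ j) b)
      ≡ 𝟙 (does (f a -ₚ f b ≟ₚ j mod p))
  intersection-pointwise {j} 0<j j<p a b = begin
    sumUpTo p (λ k → 𝟙 (inD p f ((j + k) % p) a ∧ inD p f k b)) + 𝟙 (inD p f p a ∧ inD p f (p ∸ j) b)
      ≡⟨ cong₂ _+_ (sumUpTo-cong p λ k → cong₂ (λ s t → 𝟙 (s ∧ t)) (inD≡class ((j + k) % p) a) (inD≡class k b))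
                   (cong₂ (λ s t → 𝟙 (s ∧ t)) (inD≡class p a) (inD≡class (p ∸ j) b)) ⟩
    sumUpTo p (λ k → 𝟙 (((j + k) % p ℕ.≡ᵇ A) ∧ (k ℕ.≡ᵇ B))) + 𝟙 ((p ℕ.≡ᵇ A) ∧ (p ∸ j ℕ.≡ᵇ B))
      ≡⟨ cong (_+ 𝟙 ((p ℕ.≡ᵇ A) ∧ (p ∸ j ℕ.≡ᵇ B))) (trans
           (sumUpTo-cong p λ k → trans (𝟙-∧ ((j + k) % p ℕ.≡ᵇ A) (k ℕ.≡ᵇ B)) (ℕ.*-comm _ (𝟙 (k ℕ.≡ᵇ B))))
           (sumUpTo-indicator p B (λ k → 𝟙 ((j + k) % p ℕ.≡ᵇ A)) (class≤p b))) ⟩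
    𝟙 ((j + B) % p ℕ.≡ᵇ A) + 𝟙 ((p ℕ.≡ᵇ A) ∧ (p ∸ j ℕ.≡ᵇ B))
      ≡⟨ 𝟙-intersection 0<j j<p (class≤p a) (class≤p b) ⟩
    𝟙 (A % p ℕ.≡ᵇ (j + B) % p)
      ≡⟨ cong 𝟙 (does-⇔ (⇔.sym (f-difference⇔class a b j)) (A % p ℕ.≟ (j + B) % p) (f a -ₚ f b ≟ₚ j mod p)) ⟩
    𝟙 (does (f a -ₚ f b ≟ₚ j mod p))
      ∎
    where
    open ≡-Reasoning
    A B : ℕ
    A = class a
    B = class b

  intersectionSum : ℕ → Vec (Fin p) n → Vec (Fin p) n → ℕ
  intersectionSum j x y = sumUpTo p (λ k → ρ p f ((j + k) % p) k x y) + ρ p f p (p ∸ j) x y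

  intersectionSum≡fibre : Even p f → ∀ {j} → 0 < j → j < p → ∀ x y →
    intersectionSum j x y ≡ fibre (Δ (x -ᵥ y)) (j mod p)
  intersectionSum≡fibre even {j} 0<j j<p x y = begin
    intersectionSum j x y
      ≡⟨ cong₂ _+_ (sumUpTo-cong p λ k → count-allV n (λ z → pair ((j + k) % p) k z)) (count-allV n (pair p (p ∸ j))) ⟩
    sumUpTo p (λ k → ∑ᵥ (λ z → 𝟙 (pair ((j + k) % p) k z))) + ∑ᵥ (λ z → 𝟙 (pair p (p ∸ j) z))
      ≡⟨ cong (_+ ∑ᵥ (λ z → 𝟙 (pair p (p ∸ j) z))) (sumUpTo-∑ᵥ p (λ k z → 𝟙 (pair ((j + k) % p) k z))) ⟩
    ∑ᵥ (λ z → sumUpTo p (λ k → 𝟙 (pair ((j + k) % p) k z))) + ∑ᵥ (λ z → 𝟙 (pair p (p ∸ j) z))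
      ≡⟨ ∑ᵥ-distrib-+ (λ z → sumUpTo p (λ k → 𝟙 (pair ((j + k) % p) k z))) (λ z → 𝟙 (pair p (p ∸ j) z)) ⟨
    ∑ᵥ (λ z → sumUpTo p (λ k → 𝟙 (pair ((j + k) % p) k z)) + 𝟙 (pair p (p ∸ j) z))
      ≡⟨ ∑ᵥ-cong (λ z → intersection-pointwise 0<j j<p (x -ᵥ z) (z -ᵥ y)) ⟩
    ∑ᵥ (λ z → 𝟙 (does (f (x -ᵥ z) -ₚ f (z -ᵥ y) ≟ₚ j mod p)))
      ≡⟨ ∑ᵥ-reflect x (λ z → 𝟙 (does (f (x -ᵥ z) -ₚ f (z -ᵥ y) ≟ₚ j mod p))) ⟨
    ∑ᵥ (λ a → 𝟙 (does (f (x -ᵥ (x -ᵥ a)) -ₚ f ((x -ᵥ a) -ᵥ y) ≟ₚ j mod p)))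
      ≡⟨ ∑ᵥ-cong (λ a → cong (λ c → 𝟙 (does (c ≟ₚ j mod p))) (cong₂ _-ₚ_
           (cong f (x-ᵥ[x-ᵥy]≡y x a))
           (trans (cong f ([x-ᵥy]-ᵥz≡-[y-ᵥ[x-ᵥz]] x a y)) (even (a -ᵥ (x -ᵥ y)))))) ⟩
    fibre (Δ (x -ᵥ y)) (j mod p)
      ∎
    where
    open ≡-Reasoning
    pair : ℕ → ℕ → Vec (Fin p) n → Bool
    pair i k z = inD p f i (x -ᵥ z) ∧ inD p f k (z -ᵥ y)

  IntersectionCondition : Set
  IntersectionCondition = ∀ i j → 1 ≤ i → i ≤ p → 1 ≤ j → j ≤ p ∸ 1 →
    ∀ x y → R p f i x y → intersectionSum j x y ≡ p ^ (n ∸ 1)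

  balanced⇒intersectionCondition : Even p f → (∀ w → w ≢ 0ᵥ → ∀ c → fibre (Δ w) c ≡ p ^ (n ∸ 1)) →
    IntersectionCondition
  balanced⇒intersectionCondition even balanced i j 1≤i _ 1≤j j≤p-1 x y xRy =
    trans (intersectionSum≡fibre even 1≤j (≤pred⇒< j≤p-1) x y)
          (balanced (x -ᵥ y) (related⇒≢0ᵥ x y 1≤i xRy) (j mod p))

  intersectionCondition⇒balanced : Even p f → 1 ≤ n → IntersectionCondition →
    ∀ w → w ≢ 0ᵥ → ∀ c → fibre (Δ w) c ≡ p ^ (n ∸ 1)
  intersectionCondition⇒balanced even 1≤n condition w w≢0 =
    fibre-complete (Δ w) 0ₚ (p ^ (n ∸ 1)) at-nonzero (p^n≡p*p^[n∸1] 1≤n)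
    where
    at-nonzero : ∀ c → c ≢ 0ₚ → fibre (Δ w) c ≡ p ^ (n ∸ 1)
    at-nonzero c c≢0 = begin
      fibre (Δ w) c                        ≡⟨ cong₂ (λ v d → fibre (Δ v) d) (x-ᵥ0≡x w) (mod-toℕ c) ⟨
      fibre (Δ (w -ᵥ 0ᵥ)) (toℕ c mod p)    ≡⟨ intersectionSum≡fibre even 0<c (toℕ<n c) w 0ᵥ ⟨
      intersectionSum (toℕ c) w 0ᵥ         ≡⟨ condition (class w) (toℕ c) (class≥1 w w≢0) (class≤p w) 0<c
                                                (ℕ.<⇒≤pred (toℕ<n c)) w 0ᵥ (related-to-class w) ⟩
      p ^ (n ∸ 1)                          ∎
      where
      open ≡-Reasoning
      0<c : 0 < toℕ c
      0<c = ℕ.n≢0⇒n>0 (toℕ≢0 c≢0)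

proposition8p3 : (p : ℕ) .{{_ : NonZero p}} → Prime p → 2 < p →
    (n : ℕ) → 1 ≤ n → (f : Vec (Fin p) n → Fin p) →
    Even p f → f (zeroV p n) ≡ 0F p → DeterminesAS p f →
    Bent p f ⇔
      (∀ i j → 1 ≤ i → i ≤ p → 1 ≤ j → j ≤ p ∸ 1 →
        ∀ x y → R p f i x y →
          sumUpTo p (λ k → ρ p f ((j + k) % p) k x y) + ρ p f p (p ∸ j) x y
            ≡ p ^ (n ∸ 1))
proposition8p3 p p-prime _ n 1≤n f even f0≡0 _ = mk⇔
  (λ bent → balanced⇒intersectionCondition even (bent⇒balanced p-prime 1≤n bent))
  (λ condition → balanced⇒bent (p ^ (n ∸ 1)) (intersectionCondition⇒balanced even 1≤n condition))
  where
  open Spectrum p f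
  open Classes p f f0≡0
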